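{- Let $m,n\ge 1$ and let $B$ be the $m\times n$ rectangular chessboard. There is no open knight's tour on $B$ (i.e. no Hamiltonian path in the knight's graph of $B$) that is crosspatch, i.e. in which every knight move of the tour forms a cross with some other knight move of the tour.
   Context: Represent the square in column $i$ and row $j$ of $B$ ($1\le i\le m$, $1\le j\le n$) by the point $(i,j)$ of the plane, and represent a knight move between two squares by the straight segment joining the corresponding points. Two knight moves form a cross (central cross) if the midpoints of their segments coincide. A set of knight moves (a knight graph) is called crosspatch if every move in it forms a cross with some other move in the set. -}

module Defs where

open import Data.Nat using (ℕ; _+_; ∣_-_∣)
open import Data.Fin using (Fin; toℕ)
open import Data.Product using (_×_; _,_; ∃-syntax)
open import Data.Sum using (_⊎_)
open import Data.List using (List; _∷_; _++_)
open import Data.List.Membership.Propositional using (_∈_)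
open import Data.List.Relation.Unary.Unique.Propositional using (Unique)
open import Data.List.Relation.Unary.Linked using (Linked)
open import Relation.Binary.PropositionalEquality using (_≡_)
open import Relation.Nullary using (¬_)

-- A square of the m×n board: column i, row j (0-indexed; shifting
-- coordinates by 1 does not affect knight moves or midpoints).
Square : ℕ → ℕ → Set
Square m n = Fin m × Fin n

col : ∀ {m n} → Square m n → ℕ
col (i , _) = toℕ i

row : ∀ {m n} → Square m n → ℕ
row (_ , j) = toℕ j

KnightMove : ∀ {m n} → Square m n → Square m n → Set
KnightMove a b =
  (∣ col a - col b ∣ ≡ 1 × ∣ row a - row b ∣ ≡ 2) ⊎
  (∣ col a - col b ∣ ≡ 2 × ∣ row a - row b ∣ ≡ 1)

record OpenKnightsTour (m n : ℕ) : Set where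
  field
    path     : List (Square m n)
    distinct : Unique path
    covers   : ∀ (s : Square m n) → s ∈ path
    moves    : Linked KnightMove path

IsMoveOf : ∀ {A : Set} → List A → A → A → Set
IsMoveOf {A} xs a b = ∃[ ys ] ∃[ zs ] (xs ≡ ys ++ (a ∷ b ∷ zs))

SameMidpoint : ∀ {m n} → Square m n → Square m n → Square m n → Square m n → Set
SameMidpoint a b c d =
  (col a + col b ≡ col c + col d) × (row a + row b ≡ row c + row d)

Crosspatch : ∀ {m n} → List (Square m n) → Set
Crosspatch xs = ∀ a b → IsMoveOf xs a b →
  ∃[ c ] ∃[ d ] (IsMoveOf xs c d × ¬ (a ≡ c × b ≡ d) × SameMidpoint a b c d)

-- Two crossing knight moves are the two diagonals of a 1×2 rectangle, so the partner of a move
-- joins the same two columns and the same two rows.  Colour the board by "same column as the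
-- first square of the path" (or "same row"): every move of a crosspatch path that changes colour
-- is paired with a distinct one that also changes colour, so colour changes are even in number
-- and the path ends in the colour it started with.  Hence a crosspatch knight path ends in the
-- column and in the row where it starts, i.e. at its first square, which is impossible for a
-- path with distinct squares covering a board of at least two squares.
module Submission where

open import Defs
open import Algebra.Bundles using (CommutativeRing)
open import Data.Bool using (Bool; true; false; _xor_; T; not; if_then_else_)
open import Data.Bool.Properties using (xor-same; xor-comm; xor-assoc; xor-∧-commutativeRing)
open import Data.Empty using (⊥-elim)
open import Data.Fin using (zero; suc)
open import Data.Fin.Properties using (toℕ-injective)
open import Data.List using (List; []; _∷_; _++_; map; foldr; length)
open import Data.List.Properties using (map-∘; map-cong)
open import Data.List.Membership.Propositional using (_∈_; _∉_)
open import Data.List.Membership.Propositional.Properties using (∈-∃++; ∈-map⁺; ∈-map⁻)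
open import Data.List.Relation.Unary.All as All using (All; []; _∷_)
open import Data.List.Relation.Unary.AllPairs using (AllPairs; []; _∷_)
import Data.List.Relation.Unary.AllPairs.Properties as AllPairs
open import Data.List.Relation.Unary.Any using (here; there)
open import Data.List.Relation.Unary.Linked using (Linked; []; [-]; _∷_)
open import Data.List.Relation.Unary.Unique.Propositional as Unique using (Unique)
open import Data.List.Relation.Binary.Permutation.Propositional using (_↭_; ↭-prep; ↭-sym; ↭⇒↭ₛ)
open import Data.List.Relation.Binary.Permutation.Propositional.Properties using (shift; ↭-length; ∈-resp-↭) renaming (map⁺ to ↭-map⁺)
import Data.List.Relation.Binary.Permutation.Setoid.Properties as SetoidPermutation
open import Data.Nat using (ℕ; zero; suc; _+_; _*_; _≥_; _<_; ∣_-_∣; _<ᵇ_; _≡ᵇ_; s≤s; parity)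
open import Data.Nat.Properties using (m<n⇒m<1+n; ≤-reflexive; +-comm; +-suc; +-identityʳ; +-cancelˡ-≡; *-cancelˡ-≡; ∣n-n∣≡0; ≡ᵇ⇒≡; ≡⇒≡ᵇ)
open import Data.Nat.Induction using (<-wellFounded)
open import Data.Nat.Tactic.RingSolver using (solve-∀)
open import Induction.WellFounded using (Acc; acc)
open import Data.Product using (_×_; _,_; proj₁; proj₂; ∃-syntax; Σ-syntax; swap; uncurry)
open import Function using (_∘_)
open import Data.Sum as Sum using (_⊎_; inj₁; inj₂)
open import Relation.Binary.PropositionalEquality
open import Relation.Nullary using (¬_)

∣-∣≡⇒+ : ∀ x y {k} → ∣ x - y ∣ ≡ k → x ≡ y + k ⊎ y ≡ x + k
∣-∣≡⇒+ zero    y       refl = inj₂ refl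
∣-∣≡⇒+ (suc x) zero    refl = inj₁ refl
∣-∣≡⇒+ (suc x) (suc y) d    = Sum.map (cong suc) (cong suc) (∣-∣≡⇒+ x y d)

parity-∣-∣ : ∀ m n → parity ∣ m - n ∣ ≡ parity (m + n)
parity-∣-∣ zero    n       = refl
parity-∣-∣ (suc m) zero    = cong parity (sym (+-identityʳ (suc m)))
parity-∣-∣ (suc m) (suc n) = trans (parity-∣-∣ m n) (cong (parity ∘ suc) (sym (+-suc m n)))

same-sum⇒same-distance-parity : ∀ x y u v → x + y ≡ u + v → parity ∣ x - y ∣ ≡ parity ∣ u - v ∣
same-sum⇒same-distance-parity x y u v s =
  trans (parity-∣-∣ x y) (trans (cong parity s) (sym (parity-∣-∣ u v)))

same-sum⇒distance≢1,2 : ∀ x y u v → ∣ x - y ∣ ≡ 1 → ∣ u - v ∣ ≡ 2 → x + y ≢ u + v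
same-sum⇒distance≢1,2 x y u v d₁ d₂ s
  with () ← trans (sym (cong parity d₁)) (trans (same-sum⇒same-distance-parity x y u v s) (cong parity d₂))

same-sum-and-offset⇒same-pair : ∀ {x y u v k} → x ≡ y + k → u ≡ v + k → x + y ≡ u + v → u ≡ x × v ≡ y
same-sum-and-offset⇒same-pair {y = y} {v = v} {k} refl refl s = cong (_+ k) (sym y≡v) , sym y≡v
  where
  normal : ∀ y k → y + k + y ≡ k + 2 * y
  normal = solve-∀
  y≡v : y ≡ v
  y≡v = *-cancelˡ-≡ y v 2 (+-cancelˡ-≡ k _ _ (trans (sym (normal y k)) (trans s (normal v k))))

same-sum-and-distance⇒same-pair : ∀ x y u v → x + y ≡ u + v → ∣ x - y ∣ ≡ ∣ u - v ∣ →
  (u ≡ x × v ≡ y) ⊎ (u ≡ y × v ≡ x)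
same-sum-and-distance⇒same-pair x y u v s d
  with ∣-∣≡⇒+ x y refl | ∣-∣≡⇒+ u v (sym d)
... | inj₁ x≡ | inj₁ u≡ = inj₁ (same-sum-and-offset⇒same-pair x≡ u≡ s)
... | inj₁ x≡ | inj₂ v≡ = inj₂ (swap (same-sum-and-offset⇒same-pair x≡ v≡ (trans s (+-comm u v))))
... | inj₂ y≡ | inj₁ u≡ = inj₂ (same-sum-and-offset⇒same-pair y≡ u≡ (trans (+-comm y x) s))
... | inj₂ y≡ | inj₂ v≡ =
  inj₁ (swap (same-sum-and-offset⇒same-pair y≡ v≡ (trans (+-comm y x) (trans s (+-comm u v)))))

∣-∣≡suc⇒≢ : ∀ {x y k} → ∣ x - y ∣ ≡ suc k → x ≢ y
∣-∣≡suc⇒≢ {x} d refl with () ← trans (sym (∣n-n∣≡0 x)) d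

<ᵇ-flip : ∀ x y → x ≢ y → (y <ᵇ x) ≡ not (x <ᵇ y)
<ᵇ-flip zero    zero    x≢y = ⊥-elim (x≢y refl)
<ᵇ-flip zero    (suc y) _   = refl
<ᵇ-flip (suc x) zero    _   = refl
<ᵇ-flip (suc x) (suc y) x≢y = <ᵇ-flip x y (x≢y ∘ cong suc)

module _ {m n : ℕ} where

  ≡-Square : {a b : Square m n} → col a ≡ col b → row a ≡ row b → a ≡ b
  ≡-Square c r = cong₂ _,_ (toℕ-injective c) (toℕ-injective r)

  corner : Square m n → Square m n → Square m n
  corner (i , _) (_ , j) = i , j

  opposite : Square m n × Square m n → Square m n × Square m n
  opposite (a , b) = corner a b , corner b a

  -- Forgets the direction of a move (faithfully only when its two columns differ).
  orient : Square m n × Square m n → Square m n × Square m n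
  orient (a , b) = if col a <ᵇ col b then (a , b) else (b , a)

  orient-cases : ∀ p → orient p ≡ p ⊎ orient p ≡ swap p
  orient-cases (a , b) with col a <ᵇ col b
  ... | true  = inj₁ refl
  ... | false = inj₂ refl

  orient-≡ : ∀ {p q} → orient p ≡ orient q → p ≡ q ⊎ p ≡ swap q
  orient-≡ {p} {q} e with orient-cases p | orient-cases q
  ... | inj₁ p≡ | inj₁ q≡ = inj₁ (trans (sym p≡) (trans e q≡))
  ... | inj₁ p≡ | inj₂ q≡ = inj₂ (trans (sym p≡) (trans e q≡))
  ... | inj₂ p≡ | inj₁ q≡ = inj₂ (cong swap (trans (sym p≡) (trans e q≡)))
  ... | inj₂ p≡ | inj₂ q≡ = inj₁ (cong swap (trans (sym p≡) (trans e q≡)))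

  orient-swap : ∀ {a b : Square m n} → col a ≢ col b → orient (b , a) ≡ orient (a , b)
  orient-swap {a} {b} ne rewrite <ᵇ-flip (col a) (col b) ne with col a <ᵇ col b
  ... | true  = refl
  ... | false = refl

  orient-opposite : ∀ p → orient (opposite p) ≡ opposite (orient p)
  orient-opposite (a , b) with col a <ᵇ col b
  ... | true  = refl
  ... | false = refl

  opposite-orient≢ : ∀ {a b : Square m n} → row a ≢ row b → opposite (orient (a , b)) ≢ orient (a , b)
  opposite-orient≢ {a} {b} ne with col a <ᵇ col b
  ... | true  = λ e → ne (sym (cong (row ∘ proj₁) e))
  ... | false = λ e → ne (cong (row ∘ proj₁) e)

  knightMove⇒≢ : ∀ (a b : Square m n) → KnightMove a b → col a ≢ col b × row a ≢ row b
  knightMove⇒≢ _ _ (inj₁ (c , r)) = ∣-∣≡suc⇒≢ c , ∣-∣≡suc⇒≢ r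
  knightMove⇒≢ _ _ (inj₂ (c , r)) = ∣-∣≡suc⇒≢ c , ∣-∣≡suc⇒≢ r

  crossing⇒same-distances : ∀ (a b c d : Square m n) → KnightMove a b → KnightMove c d → SameMidpoint a b c d →
    ∣ col a - col b ∣ ≡ ∣ col c - col d ∣ × ∣ row a - row b ∣ ≡ ∣ row c - row d ∣
  crossing⇒same-distances _ _ _ _ (inj₁ (c₁ , r₁)) (inj₁ (c₂ , r₂)) _ = trans c₁ (sym c₂) , trans r₁ (sym r₂)
  crossing⇒same-distances _ _ _ _ (inj₂ (c₁ , r₁)) (inj₂ (c₂ , r₂)) _ = trans c₁ (sym c₂) , trans r₁ (sym r₂)
  crossing⇒same-distances a b c d (inj₁ (c₁ , _)) (inj₂ (c₂ , _)) (s , _) =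
    ⊥-elim (same-sum⇒distance≢1,2 (col a) (col b) (col c) (col d) c₁ c₂ s)
  crossing⇒same-distances a b c d (inj₂ (c₁ , _)) (inj₁ (c₂ , _)) (s , _) =
    ⊥-elim (same-sum⇒distance≢1,2 (col c) (col d) (col a) (col b) c₂ c₁ (sym s))

  crossing-cases : ∀ (a b c d : Square m n) → KnightMove a b → KnightMove c d → SameMidpoint a b c d →
    (c , d) ≡ (a , b) ⊎ (c , d) ≡ (b , a) ⊎ (c , d) ≡ opposite (a , b) ⊎ (c , d) ≡ opposite (b , a)
  crossing-cases a b c d ab cd mid@(cols , rows) with crossing⇒same-distances a b c d ab cd mid
  ... | Δcols , Δrows
    with same-sum-and-distance⇒same-pair (col a) (col b) (col c) (col d) cols Δcols
       | same-sum-and-distance⇒same-pair (row a) (row b) (row c) (row d) rows Δrows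
  ... | inj₁ (c₁ , d₁) | inj₁ (c₂ , d₂) = inj₁ (cong₂ _,_ (≡-Square c₁ c₂) (≡-Square d₁ d₂))
  ... | inj₂ (c₁ , d₁) | inj₂ (c₂ , d₂) = inj₂ (inj₁ (cong₂ _,_ (≡-Square c₁ c₂) (≡-Square d₁ d₂)))
  ... | inj₁ (c₁ , d₁) | inj₂ (c₂ , d₂) = inj₂ (inj₂ (inj₁ (cong₂ _,_ (≡-Square c₁ c₂) (≡-Square d₁ d₂))))
  ... | inj₂ (c₁ , d₁) | inj₁ (c₂ , d₂) = inj₂ (inj₂ (inj₂ (cong₂ _,_ (≡-Square c₁ c₂) (≡-Square d₁ d₂))))

  crossing-partner : ∀ (a b c d : Square m n) → KnightMove a b → KnightMove c d → SameMidpoint a b c d →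
    (c , d) ≢ (a , b) → (c , d) ≢ (b , a) → orient (c , d) ≡ opposite (orient (a , b))
  crossing-partner a b c d ab cd mid ≢ab ≢ba with crossing-cases a b c d ab cd mid
  ... | inj₁ e                 = ⊥-elim (≢ab e)
  ... | inj₂ (inj₁ e)          = ⊥-elim (≢ba e)
  ... | inj₂ (inj₂ (inj₁ refl)) = orient-opposite (a , b)
  ... | inj₂ (inj₂ (inj₂ refl)) =
    trans (orient-opposite (b , a)) (cong opposite (orient-swap (proj₁ (knightMove⇒≢ a b ab))))

module _ {A : Set} where

  moves : List A → List (A × A)
  moves (x ∷ y ∷ xs) = (x , y) ∷ moves (y ∷ xs)
  moves _            = []

  lastOf : A → List A → A
  lastOf x []       = x
  lastOf _ (y ∷ xs) = lastOf y xs

  lastOf-∈ : ∀ x xs → lastOf x xs ∈ x ∷ xs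
  lastOf-∈ x []       = here refl
  lastOf-∈ x (y ∷ xs) = there (lastOf-∈ y xs)

  ∈-moves-∷ : ∀ {p x} xs → p ∈ moves xs → p ∈ moves (x ∷ xs)
  ∈-moves-∷ (_ ∷ _ ∷ _) p∈ = there p∈

  IsMoveOf⇒∈-moves : ∀ {xs a b} → IsMoveOf xs a b → (a , b) ∈ moves xs
  IsMoveOf⇒∈-moves ([]     , zs , refl) = here refl
  IsMoveOf⇒∈-moves (y ∷ ys , zs , refl) = ∈-moves-∷ (ys ++ _) (IsMoveOf⇒∈-moves (ys , zs , refl))

  ∈-moves⇒IsMoveOf : ∀ {xs a b} → (a , b) ∈ moves xs → IsMoveOf xs a b
  ∈-moves⇒IsMoveOf {x ∷ y ∷ xs} (here refl) = [] , xs , refl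
  ∈-moves⇒IsMoveOf {x ∷ y ∷ xs} (there ab∈)
    with ys , zs , e ← ∈-moves⇒IsMoveOf {y ∷ xs} ab∈ = x ∷ ys , zs , cong (x ∷_) e

  ∈-moves⇒∈ : ∀ {xs a b} → (a , b) ∈ moves xs → a ∈ xs × b ∈ xs
  ∈-moves⇒∈ {x ∷ y ∷ xs} (here refl) = here refl , there (here refl)
  ∈-moves⇒∈ {x ∷ y ∷ xs} (there ab∈) with a∈ , b∈ ← ∈-moves⇒∈ {y ∷ xs} ab∈ = there a∈ , there b∈

  Linked⇒All-moves : ∀ {R : A → A → Set} {xs} → Linked R xs → All (uncurry R) (moves xs)
  Linked⇒All-moves []       = []
  Linked⇒All-moves [-]      = []
  Linked⇒All-moves (r ∷ rs) = r ∷ Linked⇒All-moves rs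

  Unique⇒reversed-move-∉ : ∀ {xs a b} → Unique xs → (a , b) ∈ moves xs → (b , a) ∉ moves xs
  Unique⇒reversed-move-∉ {x ∷ y ∷ xs} (x∉ ∷ _) (here refl) (here ba≡ab) = All.lookup x∉ (here refl) (sym (cong proj₁ ba≡ab))
  Unique⇒reversed-move-∉ {x ∷ y ∷ xs} (x∉ ∷ _) (here refl) (there ba∈)  = All.lookup x∉ (proj₂ (∈-moves⇒∈ ba∈)) refl
  Unique⇒reversed-move-∉ {x ∷ y ∷ xs} (x∉ ∷ _) (there ab∈) (here refl)  = All.lookup x∉ (proj₂ (∈-moves⇒∈ ab∈)) refl
  Unique⇒reversed-move-∉ {x ∷ y ∷ xs} (_ ∷ u)  (there ab∈) (there ba∈)  = Unique⇒reversed-move-∉ u ab∈ ba∈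

  Unique⇒Unique-map-moves : ∀ {B : Set} (g : A × A → B) → (∀ {p q} → g p ≡ g q → p ≡ q ⊎ p ≡ swap q) →
    ∀ {xs} → Unique xs → Unique (map g (moves xs))
  Unique⇒Unique-map-moves g g-≡ = AllPairs.map⁺ ∘ distinct
    where
    distinct : ∀ {xs} → Unique xs → AllPairs (λ p q → g p ≢ g q) (moves xs)
    distinct {[]}         _         = []
    distinct {_ ∷ []}     _         = []
    distinct {x ∷ y ∷ xs} (x∉ ∷ u) = All.tabulate differs ∷ distinct u
      where
      differs : ∀ {q} → q ∈ moves (y ∷ xs) → g (x , y) ≢ g q
      differs q∈ e with g-≡ e | ∈-moves⇒∈ q∈
      ... | inj₁ refl | x∈ , _ = All.lookup x∉ x∈ refl
      ... | inj₂ refl | _ , x∈ = All.lookup x∉ x∈ refl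

xorSum : List Bool → Bool
xorSum = foldr _xor_ false

xorSum-↭ : ∀ {xs ys} → xs ↭ ys → xorSum xs ≡ xorSum ys
xorSum-↭ = SetoidPermutation.foldr-commMonoid (setoid Bool) ⊕.+-isCommutativeMonoid ∘ ↭⇒↭ₛ
  where module ⊕ = CommutativeRing xor-∧-commutativeRing

xor≡false⇒≡ : ∀ {a b} → a xor b ≡ false → a ≡ b
xor≡false⇒≡ {false} {false} _ = refl
xor≡false⇒≡ {true}  {true}  _ = refl

xor-cancel-middle : ∀ a b c → (a xor b) xor (b xor c) ≡ a xor c
xor-cancel-middle a b c = begin
  (a xor b) xor (b xor c) ≡⟨ xor-assoc a b (b xor c) ⟩
  a xor (b xor (b xor c)) ≡⟨ cong (a xor_) (xor-assoc b b c) ⟨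
  a xor ((b xor b) xor c) ≡⟨ cong (λ z → a xor (z xor c)) (xor-same b) ⟩
  a xor c                 ∎
  where open ≡-Reasoning

module _ {A : Set} where

  flips : (A → Bool) → A × A → Bool
  flips h (a , b) = h a xor h b

  xorSum-flips-moves : ∀ h x xs → xorSum (map (flips h) (moves (x ∷ xs))) ≡ h x xor h (lastOf x xs)
  xorSum-flips-moves h x []       = sym (xor-same (h x))
  xorSum-flips-moves h x (y ∷ xs) =
    trans (cong (flips h (x , y) xor_) (xorSum-flips-moves h y xs)) (xor-cancel-middle (h x) (h y) _)

  ∈⇒↭-∷ : ∀ {v xs} → v ∈ xs → Σ[ rest ∈ List A ] xs ↭ v ∷ rest
  ∈⇒↭-∷ {v} v∈ with ys , zs , refl ← ∈-∃++ v∈ = ys ++ zs , shift v ys zs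

  module _ (f : A → A) (w : A → Bool) where

    PairedUp : List A → Set
    PairedUp xs = ∀ {x} → x ∈ xs → f x ∈ xs × f x ≢ x × w (f x) ≡ w x

    xorSum-pairedUp : (∀ x → f (f x) ≡ x) → ∀ {xs} → Unique xs → PairedUp xs → xorSum (map w xs) ≡ false
    xorSum-pairedUp f-involutive {xs} = go xs (<-wellFounded (length xs))
      where
      go : ∀ xs → Acc _<_ (length xs) → Unique xs → PairedUp xs → xorSum (map w xs) ≡ false
      go []       _         _ _ = refl
      go (x ∷ xs) (acc rec) u paired with paired (here refl)
      ... | here fx≡x , fx≢x , _ = ⊥-elim (fx≢x fx≡x)
      ... | there fx∈ , _ , wfx≡wx with rest , xs↭ ← ∈⇒↭-∷ fx∈ = begin
        xorSum (map w (x ∷ xs))                   ≡⟨ xorSum-↭ (↭-map⁺ w σ) ⟩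
        w x xor (w (f x) xor xorSum (map w rest)) ≡⟨ cong (λ b → w x xor (b xor xorSum (map w rest))) wfx≡wx ⟩
        w x xor (w x xor xorSum (map w rest))     ≡⟨ xor-cancel-middle false (w x) _ ⟩
        xorSum (map w rest)                       ≡⟨ go rest (rec shorter) u-rest paired-rest ⟩
        false                                     ∎
        where
        open ≡-Reasoning
        σ : x ∷ xs ↭ x ∷ f x ∷ rest
        σ = ↭-prep x xs↭
        shorter : length rest < length (x ∷ xs)
        shorter = m<n⇒m<1+n (≤-reflexive (sym (↭-length xs↭)))
        u′ : Unique (x ∷ f x ∷ rest)
        u′ = SetoidPermutation.Unique-resp-↭ (setoid A) (↭⇒↭ₛ σ) u
        x∉ = Unique.head u′
        fx∉ = Unique.head (Unique.tail u′)
        u-rest = Unique.tail (Unique.tail u′)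
        paired-rest : PairedUp rest
        paired-rest {j} j∈ with fj∈ , fj≢j , wfj≡wj ← paired (∈-resp-↭ (↭-sym σ) (there (there j∈)))
          with ∈-resp-↭ σ fj∈
        ... | here fj≡x           = ⊥-elim (All.lookup fx∉ j∈ (trans (cong f (sym fj≡x)) (f-involutive j)))
        ... | there (here fj≡fx)  = ⊥-elim (All.lookup x∉ (there j∈)
                                      (trans (sym (f-involutive x)) (trans (cong f (sym fj≡fx)) (f-involutive j))))
        ... | there (there fj∈)   = fj∈ , fj≢j , wfj≡wj

module _ {m n : ℕ} where

  CrossInvariant : (Square m n → Bool) → Set
  CrossInvariant h = ∀ p → flips h (opposite p) ≡ flips h p

  flips-orient : ∀ (h : Square m n → Bool) p → flips h (orient p) ≡ flips h p
  flips-orient h (a , b) with orient-cases (a , b)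
  ... | inj₁ e = cong (flips h) e
  ... | inj₂ e = trans (cong (flips h) e) (xor-comm (h b) (h a))

  crosspatch⇒ends-agree : ∀ (h : Square m n → Bool) → CrossInvariant h → ∀ x xs → Unique (x ∷ xs) →
    Linked KnightMove (x ∷ xs) → Crosspatch (x ∷ xs) → h x ≡ h (lastOf x xs)
  crosspatch⇒ends-agree h inv x xs u knight crosspatch = xor≡false⇒≡ (begin
    h x xor h (lastOf x xs)                 ≡⟨ xorSum-flips-moves h x xs ⟨
    xorSum (map (flips h) ms)               ≡⟨ cong xorSum (map-cong (flips-orient h) ms) ⟨
    xorSum (map (flips h ∘ orient) ms)      ≡⟨ cong xorSum (map-∘ ms) ⟩
    xorSum (map (flips h) (map orient ms))  ≡⟨ xorSum-pairedUp opposite (flips h) (λ _ → refl)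
                                                 (Unique⇒Unique-map-moves orient orient-≡ u) paired ⟩
    false                                   ∎)
    where
    open ≡-Reasoning
    ms : List (Square m n × Square m n)
    ms = moves (x ∷ xs)
    paired : PairedUp opposite (flips h) (map orient ms)
    paired p∈ with (a , b) , ab∈ , refl ← ∈-map⁻ orient p∈
      with c , d , cd-move , ≢ab , mid ← crosspatch a b (∈-moves⇒IsMoveOf ab∈) =
        subst (_∈ map orient ms) partner (∈-map⁺ orient cd∈) ,
        opposite-orient≢ (proj₂ (knightMove⇒≢ a b ab-knight)) ,
        inv (orient (a , b))
      where
      cd∈ : (c , d) ∈ ms
      cd∈ = IsMoveOf⇒∈-moves cd-move
      ab-knight : KnightMove a b
      ab-knight = All.lookup (Linked⇒All-moves knight) ab∈
      partner : orient (c , d) ≡ opposite (orient (a , b))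
      partner = crossing-partner a b c d ab-knight (All.lookup (Linked⇒All-moves knight) cd∈) mid
        (λ e → ≢ab (sym (cong proj₁ e) , sym (cong proj₂ e)))
        (λ e → Unique⇒reversed-move-∉ u ab∈ (subst (_∈ ms) e cd∈))

  col-CrossInvariant : ∀ (g : ℕ → Bool) → CrossInvariant (g ∘ col)
  col-CrossInvariant g p = refl

  row-CrossInvariant : ∀ (g : ℕ → Bool) → CrossInvariant (g ∘ row)
  row-CrossInvariant g (a , b) = xor-comm (g (row b)) (g (row a))

  crosspatch⇒ends-same-coordinate : ∀ (π : Square m n → ℕ) → (∀ g → CrossInvariant (g ∘ π)) →
    ∀ x xs → Unique (x ∷ xs) → Linked KnightMove (x ∷ xs) → Crosspatch (x ∷ xs) → π x ≡ π (lastOf x xs)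
  crosspatch⇒ends-same-coordinate π inv x xs u knight crosspatch =
    sym (≡ᵇ⇒≡ _ _ (subst T (crosspatch⇒ends-agree h (inv (_≡ᵇ π x)) x xs u knight crosspatch)
                            (≡⇒≡ᵇ (π x) (π x) refl)))
    where
    h : Square m n → Bool
    h = (_≡ᵇ π x) ∘ π

  crosspatch⇒closed : ∀ x xs → Unique (x ∷ xs) → Linked KnightMove (x ∷ xs) → Crosspatch (x ∷ xs) →
    x ≡ lastOf x xs
  crosspatch⇒closed x xs u knight crosspatch = ≡-Square
    (crosspatch⇒ends-same-coordinate col col-CrossInvariant x xs u knight crosspatch)
    (crosspatch⇒ends-same-coordinate row row-CrossInvariant x xs u knight crosspatch)

  crosspatch⇒subsingleton : ∀ {xs} → Unique xs → Linked KnightMove xs → Crosspatch xs →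
    ∀ {s s′} → s ∈ xs → s′ ∈ xs → s ≡ s′
  crosspatch⇒subsingleton {_ ∷ []}     _          _      _          (here refl) (here refl) = refl
  crosspatch⇒subsingleton {x ∷ y ∷ xs} u@(x∉ ∷ _) knight crosspatch _           _           =
    ⊥-elim (All.lookup x∉ (lastOf-∈ y xs) (crosspatch⇒closed x (y ∷ xs) u knight crosspatch))

twoSquares : ∀ {m n} → m ≥ 1 → n ≥ 1 → m * n ≥ 2 → ∃[ s ] ∃[ s′ ] _≢_ {A = Square m n} s s′
twoSquares {1}           {1}           _ _ (s≤s ())
twoSquares {1}           {suc (suc n)} _ _ _ = (zero , zero) , (zero , suc zero) , λ ()
twoSquares {suc (suc m)} {suc n}       _ _ _ = (zero , zero) , (suc zero , zero) , λ ()

theorem3 : ∀ (m n : ℕ) → m ≥ 1 → n ≥ 1 → m * n ≥ 2 →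
    (T : OpenKnightsTour m n) → ¬ Crosspatch (OpenKnightsTour.path T)
theorem3 m n m≥1 n≥1 m*n≥2 T crosspatch with s , s′ , s≢s′ ← twoSquares m≥1 n≥1 m*n≥2 =
  s≢s′ (crosspatch⇒subsingleton distinct knightPath crosspatch (covers s) (covers s′))
  where open OpenKnightsTour T renaming (moves to knightPath)
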